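{- In an open shop system, a state $s$ is unsafe if and only if it has a blocking set of machines.
   Context: An open shop system consists of $n$ jobs $J_1,\ldots,J_n$ and $m$ machines $M_1,\ldots,M_m$. Each job $J_j$ has a set $\mathcal{M}(J_j)\subseteq\{M_1,\ldots,M_m\}$ of machines on which it must be processed, in an arbitrary order; each machine $M_i$ has a positive integer capacity $\mathrm{cap}(M_i)$. There are two artificial machines $M_0$ and $M_{m+1}$ of unbounded capacity. A state $s$ specifies for every job $J_j$ a machine $M^s(J_j)\in\{M_0,\ldots,M_{m+1}\}$ on which it currently sits and a set $\mathcal{M}^s(J_j)\subseteq\mathcal{M}(J_j)\setminus\{M^s(J_j)\}$ of machines on which it still needs processing; each machine $M_i$, $1\le i\le m$, holds at most $\mathrm{cap}(M_i)$ jobs. $\mathcal{J}^s(M_i)$ is the set of jobs $J_j$ with $M^s(J_j)=M_i$. The final state $f$ has $M^f(J_j)=M_{m+1}$ and $\mathcal{M}^f(J_j)=\emptyset$ for all $j$. A state $t$ is a successor of $s$ if $t$ arises from $s$ by moving a single job $J_j$ from $M^s(J_j)$ to some machine $M\in\mathcal{M}^s(J_j)$ that currently holds fewer than $\mathrm{cap}(M)$ jobs (then $M^t(J_j)=M$, $\mathcal{M}^t(J_j)=\mathcal{M}^s(J_j)\setminus\{M\}$), or by moving a job $J_j$ with $\mathcal{M}^s(J_j)=\emptyset$ and $M^s(J_j)\ne M_{m+1}$ to $M_{m+1}$. Reachability from $s$ means via a finite sequence of successor steps. A state is safe if $f$ is reachable from it, unsafe otherwise. A machine $M$ is full in $s$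 if $|\mathcal{J}^s(M)|=\mathrm{cap}(M)$. A nonempty set $\mathcal{B}\subseteq\{M_1,\ldots,M_m\}$ is blocking for $s$ if every machine in $\mathcal{B}$ is full and every job $J$ sitting on a machine of $\mathcal{B}$ satisfies $\emptyset\neq\mathcal{M}^s(J)\subseteq\mathcal{B}$. -}

module Defs where

open import Data.Nat using (ℕ; _≤_; _<_)
open import Data.Bool using (Bool; true; false)
open import Data.Fin using (Fin)
open import Data.Fin.Properties using (_≟_)
open import Data.Fin.Subset using (Subset; _∈_; _∉_; _⊆_; _-_; ∣_∣; Nonempty) renaming (⊥ to ∅)
open import Data.Vec using (tabulate)
open import Data.Product using (Σ; ∃; _×_)
open import Data.Sum using (_⊎_)
open import Relation.Nullary using (¬_; does)
open import Relation.Binary.PropositionalEquality using (_≡_)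
open import Relation.Binary.Construct.Closure.ReflexiveTransitive using (Star)

-- Locations of a job: the artificial start machine M₀, a real machine
-- M_i (i : Fin m, i.e. M_{i+1} in the paper's 1-based numbering), or the
-- artificial terminal machine M_{m+1}.
data Loc (m : ℕ) : Set where
  start : Loc m
  mach  : Fin m → Loc m
  done  : Loc m

isAt : ∀ {m} → Loc m → Fin m → Bool
isAt start    i = false
isAt (mach k) i = does (k ≟ i)
isAt done     i = false

record OpenShop : Set where
  field
    n      : ℕ
    m      : ℕ
    req    : Fin n → Subset m
    cap    : Fin m → ℕ
    capPos : ∀ i → 1 ≤ cap i

record State (S : OpenShop) : Set where
  open OpenShop S
  field
    pos  : Fin n → Loc m
    rem  : Fin n → Subset m
    remReq   : ∀ j → rem j ⊆ req j
    remNotAt : ∀ j i → pos j ≡ mach i → i ∉ rem j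
  jobsOn : Fin m → Subset n
  jobsOn i = tabulate (λ j → isAt (pos j) i)
  field
    capOK : ∀ i → ∣ jobsOn i ∣ ≤ cap i

module _ {S : OpenShop} where
  open OpenShop S
  open State

  Others : State S → State S → Fin n → Set
  Others s t j = ∀ k → ¬ k ≡ j → (pos t k ≡ pos s k) × (rem t k ≡ rem s k)

  Step : State S → State S → Set
  Step s t = Σ (Fin n) λ j → Others s t j ×
    ( (Σ (Fin m) λ i → (i ∈ rem s j) × (∣ jobsOn s i ∣ < cap i)
          × (pos t j ≡ mach i) × (rem t j ≡ rem s j - i))
    ⊎ ((rem s j ≡ ∅) × (¬ pos s j ≡ done)
          × (pos t j ≡ done) × (rem t j ≡ ∅)) )

  IsFinal : State S → Set
  IsFinal f = ∀ j → (pos f j ≡ done) × (rem f j ≡ ∅)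

  Reachable : State S → State S → Set
  Reachable = Star Step

  Safe : State S → Set
  Safe s = ∃ λ f → Reachable s f × IsFinal f

  NotSafe : State S → Set
  NotSafe s = ¬ Safe s

  Full : State S → Fin m → Set
  Full s i = ∣ jobsOn s i ∣ ≡ cap i

  Blocking : State S → Subset m → Set
  Blocking s B = Nonempty B
    × (∀ i → i ∈ B → Full s i)
    × (∀ j i → pos s j ≡ mach i → i ∈ B → Nonempty (rem s j) × (rem s j ⊆ B))

-- A blocking set survives every step: its full machines never lose a job, since
-- every job on them still needs a machine of the set, and nothing can enter them.
-- A final state has no blocking set, so a blocked state is unsafe.
--
-- Conversely it suffices to show that a non-final state without a blocking set
-- has a successor without a blocking set; steps strictly decrease the remaining
-- work, so iterating reaches the final state.  A job that may leave for the
-- terminal machine always gives such a successor.  If no job can be moved at all,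
-- the full machines form a blocking set.  Otherwise some job can move to a free
-- machine b; if every such move creates a blocking set, the set B created by one
-- move is blocking in s except that b need not be full.  A job on a machine of
-- B - b that needs b can then be moved to b; if that creates a blocking set B′
-- too, then B ∩ B′ is a strictly smaller set of the same kind.  A minimal such B
-- has no job on B - b needing b, so B - b is blocking in s, a contradiction.

module Submission where

open import Defs
open import Data.Bool as Bool using (Bool; true; false; T)
open import Data.Bool.Properties using (T-≡)
open import Data.Empty using (⊥-elim)
open import Data.Fin using (Fin; zero; suc)
open import Data.Fin.Properties using (_≟_; suc-injective; any?; all?; ¬∀⟶∃¬)
open import Data.Fin.Subset using (Subset; _∈_; _∉_; _⊆_; _⊂_; _-_; _∩_; ⁅_⁆; ∣_∣; Nonempty; Empty)
  renaming (⊥ to ∅)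
open import Data.Fin.Subset.Properties
  using (_∈?_; _⊆?_; nonempty?; anySubset?; ∉⊥; ∣⊥∣≡0; Empty-unique; p─q⊆p; x∈p∩q⁺; x∈p∩q⁻;
         x∈p∧x≢y⇒x∈p-y; x∈p⇒∣p-x∣<∣p∣)
open import Data.Fin.Subset.Induction using (⊂-wellFounded)
open import Data.Nat as ℕ using (ℕ; zero; suc; _+_; _≤_; _<_; z≤n; s≤s)
open import Data.Nat.Induction using (<-wellFounded)
open import Data.Nat.Properties
  using (≤-trans; ≤-reflexive; ≤-antisym; ≮⇒≥; <-irrefl; 1+n≰n; n≤1+n; n<1+n; m≤m+n; +-suc; +-comm;
         +-mono-≤; +-monoʳ-<; +-mono-<-≤; +-mono-≤-<; module ≤-Reasoning)
open import Data.Product using (∃; _×_; _,_; proj₁; proj₂)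
open import Data.Sum using (_⊎_; inj₁; inj₂)
open import Data.Vec using (_∷_; there; tabulate)
open import Data.Vec.Properties using (tabulate-cong; lookup∘tabulate; []=⇒lookup; lookup⇒[]=; ≡-dec)
open import Data.Vec.Functional using (updateAt)
open import Data.Vec.Functional.Properties using (updateAt-updates; updateAt-minimal)
open import Function using (_∘_; id; const; _on_)
open import Function.Bundles using (Equivalence)
open import Induction.WellFounded using (Acc; acc)
import Relation.Binary.Construct.On as On
open import Relation.Binary.Construct.Closure.ReflexiveTransitive using (ε; _◅_)
open import Relation.Binary.PropositionalEquality using (_≡_; _≢_; refl; sym; trans; cong; cong₂; subst)
open import Relation.Nullary using (¬_; Dec; yes; no; _×-dec_; _→-dec_; ¬?)
open import Relation.Nullary.Decidable
  using (⌊_⌋; map′; dec-true; dec-false; decidable-stable; toWitness; fromWitness)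

_≟ˢ_ : ∀ {k} (p q : Subset k) → Dec (p ≡ q)
_≟ˢ_ = ≡-dec Bool._≟_

x∉p-x : ∀ {k} (p : Subset k) (x : Fin k) → x ∉ p - x
x∉p-x (_ ∷ p) zero    ()
x∉p-x (_ ∷ p) (suc x) (there x∈p-x) = x∉p-x p x x∈p-x

x∈p-y⇒x∈p : ∀ {k} {p : Subset k} {x y} → x ∈ p - y → x ∈ p
x∈p-y⇒x∈p {p = p} {y = y} = p─q⊆p p ⁅ y ⁆

x∈p-y⇒x≢y : ∀ {k} {p : Subset k} {x y} → x ∈ p - y → x ≢ y
x∈p-y⇒x≢y {p = p} {x} x∈p-x refl = x∉p-x p x x∈p-x

p⊆q⇒p-x⊆q-x : ∀ {k} {p q : Subset k} {x} → p ⊆ q → p - x ⊆ q - x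
p⊆q⇒p-x⊆q-x p⊆q y∈p-x = x∈p∧x≢y⇒x∈p-y (p⊆q (x∈p-y⇒x∈p y∈p-x)) (x∈p-y⇒x≢y y∈p-x)

∈-tabulate⁻ : ∀ {k} {h : Fin k → Bool} {x} → x ∈ tabulate h → T (h x)
∈-tabulate⁻ {h = h} {x} x∈ = Equivalence.from T-≡ (trans (sym (lookup∘tabulate h x)) ([]=⇒lookup x∈))

∈-tabulate⁺ : ∀ {k} {h : Fin k → Bool} {x} → T (h x) → x ∈ tabulate h
∈-tabulate⁺ {h = h} {x} hx = lookup⇒[]= x (tabulate h) (trans (lookup∘tabulate h x) (Equivalence.to T-≡ hx))

∣x∷p∣≡1+∣x∷q∣ : ∀ {k} x {p q : Subset k} → ∣ p ∣ ≡ suc ∣ q ∣ → ∣ x ∷ p ∣ ≡ suc ∣ x ∷ q ∣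
∣x∷p∣≡1+∣x∷q∣ true  = cong suc
∣x∷p∣≡1+∣x∷q∣ false = id

∣tabulate∣-suc : ∀ {k} (f g : Fin k → Bool) j → (∀ i → i ≢ j → g i ≡ f i) →
  f j ≡ false → g j ≡ true → ∣ tabulate g ∣ ≡ suc ∣ tabulate f ∣
∣tabulate∣-suc f g zero    agree fj gj rewrite fj | gj =
  cong suc (cong ∣_∣ (tabulate-cong (λ i → agree (suc i) λ ())))
∣tabulate∣-suc f g (suc j) agree fj gj rewrite agree zero (λ ()) =
  ∣x∷p∣≡1+∣x∷q∣ (f zero) {tabulate (g ∘ suc)} {tabulate (f ∘ suc)}
    (∣tabulate∣-suc (f ∘ suc) (g ∘ suc) j (λ i i≢j → agree (suc i) (i≢j ∘ suc-injective)) fj gj)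

∑ : ∀ {k} → (Fin k → ℕ) → ℕ
∑ {zero}  f = 0
∑ {suc k} f = f zero + ∑ (f ∘ suc)

∑-cong : ∀ {k} {f g : Fin k → ℕ} → (∀ i → f i ≡ g i) → ∑ f ≡ ∑ g
∑-cong {zero}  f≗g = refl
∑-cong {suc k} f≗g = cong₂ _+_ (f≗g zero) (∑-cong (f≗g ∘ suc))

∑-< : ∀ {k} (f g : Fin k → ℕ) j → (∀ i → i ≢ j → g i ≡ f i) → g j < f j → ∑ g < ∑ f
∑-< f g zero    agree lt = +-mono-<-≤ lt (≤-reflexive (∑-cong (λ i → agree (suc i) λ ())))
∑-< f g (suc j) agree lt = +-mono-≤-< (≤-reflexive (agree zero λ ()))
  (∑-< (f ∘ suc) (g ∘ suc) j (λ i i≢j → agree (suc i) (i≢j ∘ suc-injective)) lt)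

x<y⇒x+x+1<y+y+z : ∀ {x y} z → x < y → x + x + 1 < y + y + z
x<y⇒x+x+1<y+y+z {x} {y} z x<y = begin-strict
  x + x + 1          ≡⟨ +-comm (x + x) 1 ⟩
  suc (x + x)        <⟨ n<1+n _ ⟩
  suc (suc (x + x))  ≡⟨ cong suc (+-suc x x) ⟨
  suc x + suc x      ≤⟨ +-mono-≤ x<y x<y ⟩
  y + y              ≤⟨ m≤m+n (y + y) z ⟩
  y + y + z          ∎
  where open ≤-Reasoning

mach-injective : ∀ {m} {i k : Fin m} → mach i ≡ mach k → i ≡ k
mach-injective refl = refl

done≢mach : ∀ {m} {i : Fin m} → done ≢ mach i
done≢mach ()

_≟ᴸ_ : ∀ {m} (l l′ : Loc m) → Dec (l ≡ l′)
start  ≟ᴸ start  = yes refl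
mach i ≟ᴸ mach k = map′ (cong mach) mach-injective (i ≟ k)
done   ≟ᴸ done   = yes refl
start  ≟ᴸ mach _ = no λ ()
start  ≟ᴸ done   = no λ ()
mach _ ≟ᴸ start  = no λ ()
mach _ ≟ᴸ done   = no λ ()
done   ≟ᴸ start  = no λ ()
done   ≟ᴸ mach _ = no λ ()

isAt-mach : ∀ {m} (i : Fin m) → isAt (mach i) i ≡ true
isAt-mach i = dec-true (i ≟ i) refl

isAt≡false : ∀ {m} (l : Loc m) i → l ≢ mach i → isAt l i ≡ false
isAt≡false start    i _   = refl
isAt≡false (mach k) i k≢i = dec-false (k ≟ i) (k≢i ∘ cong mach)
isAt≡false done     i _   = refl

T-isAt : ∀ {m} (l : Loc m) i → T (isAt l i) → l ≡ mach i
T-isAt start    i ()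
T-isAt (mach k) i t with k ≟ i
... | yes k≡i = cong mach k≡i
T-isAt done     i ()

module _ {S : OpenShop} where
  open OpenShop S
  open State

  load : (Fin n → Loc m) → Fin m → ℕ
  load P i = ∣ tabulate (λ k → isAt (P k) i) ∣

  AgreeExcept : Fin n → (Fin n → Loc m) → (Fin n → Loc m) → Set
  AgreeExcept j P Q = ∀ k → k ≢ j → Q k ≡ P k

  load-enter : ∀ {P Q j i} → AgreeExcept j P Q → P j ≢ mach i → Q j ≡ mach i → load Q i ≡ suc (load P i)
  load-enter {P} {Q} {j} {i} agree Pj≢i Qj≡i =
    ∣tabulate∣-suc _ _ j (λ k k≢j → cong (λ l → isAt l i) (agree k k≢j))
      (isAt≡false (P j) i Pj≢i) (trans (cong (λ l → isAt l i) Qj≡i) (isAt-mach i))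

  load-leave : ∀ {P Q j i} → AgreeExcept j P Q → P j ≡ mach i → Q j ≢ mach i → load P i ≡ suc (load Q i)
  load-leave {P} {Q} agree Pj≡i Qj≢i = load-enter {Q} {P} (λ k k≢j → sym (agree k k≢j)) Qj≢i Pj≡i

  load-stay : ∀ {P Q j i} → AgreeExcept j P Q → P j ≢ mach i → Q j ≢ mach i → load Q i ≡ load P i
  load-stay {P} {Q} {j} {i} agree Pj≢i Qj≢i = cong ∣_∣ (tabulate-cong same)
    where
    same : ∀ k → isAt (Q k) i ≡ isAt (P k) i
    same k with k ≟ j
    ... | yes refl = trans (isAt≡false (Q k) i Qj≢i) (sym (isAt≡false (P k) i Pj≢i))
    ... | no k≢j   = cong (λ l → isAt l i) (agree k k≢j)

  Others-sym : ∀ {s t : State S} {j} → Others s t j → Others t s j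
  Others-sym others k k≢j = sym (proj₁ (others k k≢j)) , sym (proj₂ (others k k≢j))

  Others⇒AgreeExcept : ∀ {s t : State S} {j} → Others s t j → AgreeExcept j (pos s) (pos t)
  Others⇒AgreeExcept others k k≢j = proj₁ (others k k≢j)

  jobsOn⁻ : ∀ (s : State S) {i j} → j ∈ jobsOn s i → pos s j ≡ mach i
  jobsOn⁻ s {i} {j} j∈ = T-isAt (pos s j) i (∈-tabulate⁻ j∈)

  OffMachines : State S → Fin n → Subset m → Set
  OffMachines s j B = ∀ i → i ∈ B → pos s j ≢ mach i

  Closed : State S → Subset m → Set
  Closed s B = ∀ j i → pos s j ≡ mach i → i ∈ B → Nonempty (rem s j) × rem s j ⊆ B

  Closed-∩ : ∀ {s : State S} {B B′} → Closed s B → Closed s B′ → Closed s (B ∩ B′)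
  Closed-∩ {B = B} {B′} closed closed′ j i j-on-i i∈B∩B′ =
    let (i∈B , i∈B′)     = x∈p∩q⁻ B B′ i∈B∩B′
        (pending , ⊆B)  = closed j i j-on-i i∈B
        (_ , ⊆B′)       = closed′ j i j-on-i i∈B′
    in pending , λ x∈ → x∈p∩q⁺ (⊆B x∈ , ⊆B′ x∈)

  Closed-transfer : ∀ {s t : State S} {j B} → Others s t j → OffMachines t j B → Closed s B → Closed t B
  Closed-transfer {j = j} {B} others off closed k i k-on-i i∈B with k ≟ j
  ... | yes refl = ⊥-elim (off i i∈B k-on-i)
  ... | no k≢j   = let (same-pos , same-rem) = others k k≢j in
    subst (λ r → Nonempty r × r ⊆ B) (sym same-rem) (closed k i (trans (sym same-pos) k-on-i) i∈B)

  Full-transfer : ∀ {s t : State S} {j i} → Others s t j →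
    pos s j ≢ mach i → pos t j ≢ mach i → Full s i → Full t i
  Full-transfer {s} {t} others s≢i t≢i full = trans (load-stay (Others⇒AgreeExcept {s} {t} others) s≢i t≢i) full

  Blocking-transfer : ∀ {s t : State S} {j B} → Others s t j →
    OffMachines s j B → OffMachines t j B → Blocking s B → Blocking t B
  Blocking-transfer {s} {t} others off-s off-t (nonempty , full , closed) =
    nonempty , (λ i i∈B → Full-transfer {s} {t} others (off-s i i∈B) (off-t i i∈B) (full i i∈B)) ,
    Closed-transfer {s} {t} others off-t closed

  vacated-¬Full : ∀ {s t : State S} {j i} → Others s t j → pos s j ≡ mach i → pos t j ≢ mach i → ¬ Full t i
  vacated-¬Full {s} {t} {i = i} others s≡i t≢i full = 1+n≰n (begin
    suc (cap i)             ≡⟨ cong suc full ⟨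
    suc ∣ jobsOn t i ∣      ≡⟨ load-leave (Others⇒AgreeExcept {s} {t} others) s≡i t≢i ⟨
    ∣ jobsOn s i ∣          ≤⟨ capOK s i ⟩
    cap i                   ∎)
    where open ≤-Reasoning

  Step-preserves-Blocking : ∀ {s t : State S} {B} → Step s t → Blocking s B → Blocking t B
  Step-preserves-Blocking {s} {t} {B} (j , others , inj₁ (b , b∈rem , b-free , t-on-b , _))
                          blocking@(_ , full , closed) =
    Blocking-transfer {s} {t} others off-s off-t blocking
    where
    b∉B : b ∉ B
    b∉B b∈B = <-irrefl (full b b∈B) b-free
    off-s : OffMachines s j B
    off-s i i∈B j-on-i = b∉B (proj₂ (closed j i j-on-i i∈B) b∈rem)
    off-t : OffMachines t j B
    off-t i i∈B j-on-i = b∉B (subst (_∈ B) (mach-injective (trans (sym j-on-i) t-on-b)) i∈B)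
  Step-preserves-Blocking {s} {t} {B} (j , others , inj₂ (rem≡∅ , _ , t-done , _))
                          blocking@(_ , _ , closed) =
    Blocking-transfer {s} {t} others off-s off-t blocking
    where
    off-s : OffMachines s j B
    off-s i i∈B j-on-i with proj₁ (closed j i j-on-i i∈B)
    ... | x , x∈rem = ∉⊥ (subst (x ∈_) rem≡∅ x∈rem)
    off-t : OffMachines t j B
    off-t i _ j-on-i = done≢mach (trans (sym t-done) j-on-i)

  Reachable-preserves-Blocking : ∀ {s t : State S} {B} → Reachable s t → Blocking s B → Blocking t B
  Reachable-preserves-Blocking ε           blocking = blocking
  Reachable-preserves-Blocking {s} (_◅_ {j = u} step rs) blocking =
    Reachable-preserves-Blocking rs (Step-preserves-Blocking {s} {u} step blocking)

  IsFinal⇒¬Blocking : ∀ {f : State S} {B} → IsFinal f → ¬ Blocking f B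
  IsFinal⇒¬Blocking {f} final ((i , i∈B) , full , _) = 1+n≰n (begin
    1                ≤⟨ capPos i ⟩
    cap i            ≡⟨ full i i∈B ⟨
    ∣ jobsOn f i ∣   ≡⟨ cong ∣_∣ (Empty-unique idle) ⟩
    ∣ ∅ {n} ∣        ≡⟨ ∣⊥∣≡0 n ⟩
    0                ∎)
    where
    open ≤-Reasoning
    idle : Empty (jobsOn f i)
    idle (j , j∈) = done≢mach (trans (sym (proj₁ (final j))) (jobsOn⁻ f j∈))

  Relocation : State S → Fin n → Loc m → Subset m → State S → Set
  Relocation s j l r t = Others s t j × pos t j ≡ l × rem t j ≡ r

  HasRoom : State S → Fin n → Loc m → Set
  HasRoom s j l = ∀ i → l ≡ mach i → pos s j ≢ mach i × ∣ jobsOn s i ∣ < cap i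

  load-relocated≤cap : ∀ (s : State S) {j l P} → AgreeExcept j (pos s) P → P j ≡ l → HasRoom s j l →
    ∀ i → load P i ≤ cap i
  load-relocated≤cap s {j} {l} agree Pj≡l room i with l ≟ᴸ mach i | pos s j ≟ᴸ mach i
  ... | yes l≡i | _ = let (s≢i , free) = room i l≡i in
    subst (_≤ cap i) (sym (load-enter agree s≢i (trans Pj≡l l≡i))) free
  ... | no l≢i | yes s≡i =
    ≤-trans (n≤1+n _) (subst (_≤ cap i) (load-leave agree s≡i (l≢i ∘ trans (sym Pj≡l))) (capOK s i))
  ... | no l≢i | no s≢i =
    subst (_≤ cap i) (sym (load-stay agree s≢i (l≢i ∘ trans (sym Pj≡l)))) (capOK s i)

  relocate : ∀ s j l r → r ⊆ req j → (∀ i → l ≡ mach i → i ∉ r) → HasRoom s j l → ∃ (Relocation s j l r)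
  relocate s j l r r⊆req l∉r room = t , (λ k k≢j → pos′-k k k≢j , rem′-k k k≢j) , pos′-j , rem′-j
    where
    pos′ : Fin n → Loc m
    pos′ = updateAt (pos s) j (const l)
    rem′ : Fin n → Subset m
    rem′ = updateAt (rem s) j (const r)
    pos′-j : pos′ j ≡ l
    pos′-j = updateAt-updates j (pos s)
    rem′-j : rem′ j ≡ r
    rem′-j = updateAt-updates j (rem s)
    pos′-k : AgreeExcept j (pos s) pos′
    pos′-k k k≢j = updateAt-minimal k j (pos s) k≢j
    rem′-k : ∀ k → k ≢ j → rem′ k ≡ rem s k
    rem′-k k k≢j = updateAt-minimal k j (rem s) k≢j
    remReq′ : ∀ k → rem′ k ⊆ req k
    remReq′ k with k ≟ j
    ... | yes refl = subst (_⊆ req k) (sym rem′-j) r⊆req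
    ... | no k≢j   = subst (_⊆ req k) (sym (rem′-k k k≢j)) (remReq s k)
    remNotAt′ : ∀ k i → pos′ k ≡ mach i → i ∉ rem′ k
    remNotAt′ k i k-on-i with k ≟ j
    ... | yes refl = subst (i ∉_) (sym rem′-j) (l∉r i (trans (sym pos′-j) k-on-i))
    ... | no k≢j   = subst (i ∉_) (sym (rem′-k k k≢j)) (remNotAt s k i (trans (sym (pos′-k k k≢j)) k-on-i))
    t : State S
    t = record { pos = pos′ ; rem = rem′ ; remReq = remReq′ ; remNotAt = remNotAt′
               ; capOK = load-relocated≤cap s pos′-k pos′-j room }

  Movable : State S → Fin n → Fin m → Set
  Movable s j b = b ∈ rem s j × ∣ jobsOn s b ∣ < cap b

  Finishable : State S → Fin n → Set
  Finishable s j = rem s j ≡ ∅ × pos s j ≢ done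

  move : ∀ s j b → Movable s j b → ∃ (Relocation s j (mach b) (rem s j - b))
  move s j b (b∈rem , free) = relocate s j (mach b) (rem s j - b) (remReq s j ∘ x∈p-y⇒x∈p)
    (λ { i refl → x∉p-x (rem s j) i })
    (λ { i refl → (λ j-on-b → remNotAt s j i j-on-b b∈rem) , free })

  finish : ∀ s j → ∃ (Relocation s j done ∅)
  finish s j = relocate s j done ∅ (⊥-elim ∘ ∉⊥) (λ _ ()) (λ _ ())

  move-Step : ∀ {s t : State S} {j b} → Movable s j b → Relocation s j (mach b) (rem s j - b) t → Step s t
  move-Step {j = j} {b} (b∈rem , free) (others , t-on-b , rem≡) =
    j , others , inj₁ (b , b∈rem , free , t-on-b , rem≡)

  finish-Step : ∀ {s t : State S} {j} → Finishable s j → Relocation s j done ∅ t → Step s t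
  finish-Step {j = j} (rem≡∅ , ¬done) (others , t-done , rem≡) =
    j , others , inj₂ (rem≡∅ , ¬done , t-done , rem≡)

  NoBlocking : State S → Set
  NoBlocking s = ¬ ∃ (Blocking s)

  UnblockedStep : State S → Set
  UnblockedStep s = ∃ λ t → Step s t × NoBlocking t

  blocking? : ∀ (s : State S) B → Dec (Blocking s B)
  blocking? s B = nonempty? B ×-dec all? (λ i → (i ∈? B) →-dec (∣ jobsOn s i ∣ ℕ.≟ cap i))
    ×-dec all? (λ j → all? (λ i → (pos s j ≟ᴸ mach i) →-dec ((i ∈? B) →-dec
                                    (nonempty? (rem s j) ×-dec (rem s j ⊆? B)))))

  anyBlocking? : ∀ (s : State S) → Dec (∃ (Blocking s))
  anyBlocking? s = anySubset? (blocking? s)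

  finish-unblocked : ∀ {s t : State S} {j} → Relocation s j done ∅ t → NoBlocking s → NoBlocking t
  finish-unblocked {s} {t} {j} (others , t-done , _) unblocked (B , blocking@(_ , full , _)) =
    unblocked (B , Blocking-transfer {t} {s} (Others-sym {s} {t} others) off-t off-s blocking)
    where
    off-t : OffMachines t j B
    off-t i _ j-on-i = done≢mach (trans (sym t-done) j-on-i)
    off-s : OffMachines s j B
    off-s i i∈B j-on-i = vacated-¬Full {s} {t} others j-on-i (off-t i i∈B) (full i i∈B)

  NearlyBlocking : State S → Fin m → Subset m → Set
  NearlyBlocking s b B = b ∈ B × (∀ i → i ∈ B → i ≢ b → Full s i) × Closed s B × Nonempty (B - b)

  NearlyBlocking-∩ : ∀ {s : State S} {b B B′} → NearlyBlocking s b B → NearlyBlocking s b B′ →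
    Nonempty ((B ∩ B′) - b) → NearlyBlocking s b (B ∩ B′)
  NearlyBlocking-∩ {s} {B = B} {B′} (b∈B , full , closed , _) (b∈B′ , _ , closed′ , _) nonempty =
    x∈p∩q⁺ (b∈B , b∈B′) , (λ i i∈ → full i (proj₁ (x∈p∩q⁻ B B′ i∈))) , Closed-∩ {s} closed closed′ , nonempty

  NearlyBlocking⇒Blocking : ∀ {s : State S} {b B} → NearlyBlocking s b B →
    (∀ j i → pos s j ≡ mach i → i ∈ B - b → b ∉ rem s j) → Blocking s (B - b)
  NearlyBlocking⇒Blocking {s} {b} {B} (_ , full , closed , nonempty) b-unneeded =
    nonempty , (λ i i∈ → full i (x∈p-y⇒x∈p i∈) (x∈p-y⇒x≢y i∈)) , closed-minus
    where
    closed-minus : Closed s (B - b)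
    closed-minus j i j-on-i i∈ = let (pending , ⊆B) = closed j i j-on-i (x∈p-y⇒x∈p i∈) in
      pending , λ x∈ → x∈p∧x≢y⇒x∈p-y (⊆B x∈) λ { refl → b-unneeded j i j-on-i i∈ x∈ }

  -- What a move of j onto b that creates the blocking set B tells about the state before it.
  Obstructs : State S → Fin n → Fin m → Subset m → Set
  Obstructs s j b B = NearlyBlocking s b B × rem s j ⊆ B × Nonempty (rem s j - b) × OffMachines s j B

  move-blocked : ∀ {s t : State S} {j b B} → NoBlocking s → b ∈ rem s j →
    Relocation s j (mach b) (rem s j - b) t → Blocking t B → Obstructs s j b B
  move-blocked {s} {t} {j} {b} {B} unblocked b∈rem (others , t-on-b , rem≡) blocking@(_ , full , closed) =
    (b∈B , full-s , Closed-transfer {t} {s} back off-s closed , Nonempty-B-b) , rem⊆B , Nonempty-rem-b , off-s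
    where
    back : Others t s j
    back = Others-sym {s} {t} others
    off-s : OffMachines s j B
    off-s a a∈B j-on-a with a ≟ b
    ... | yes refl = remNotAt s j a j-on-a b∈rem
    ... | no a≢b   =
      vacated-¬Full {s} {t} others j-on-a (λ e → a≢b (sym (mach-injective (trans (sym t-on-b) e)))) (full a a∈B)
    b∈B : b ∈ B
    b∈B = decidable-stable (b ∈? B) λ b∉B →
      unblocked (B , Blocking-transfer {t} {s} back
        (λ a a∈B e → b∉B (subst (_∈ B) (mach-injective (trans (sym e) t-on-b)) a∈B)) off-s blocking)
    full-s : ∀ i → i ∈ B → i ≢ b → Full s i
    full-s i i∈B i≢b =
      Full-transfer {t} {s} back (λ e → i≢b (mach-injective (trans (sym e) t-on-b))) (off-s i i∈B) (full i i∈B)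
    Nonempty-rem-b : Nonempty (rem s j - b)
    Nonempty-rem-b = subst Nonempty rem≡ (proj₁ (closed j b t-on-b b∈B))
    rem⊆B : rem s j ⊆ B
    rem⊆B {x} x∈rem with x ≟ b
    ... | yes refl = b∈B
    ... | no x≢b   = proj₂ (closed j b t-on-b b∈B) (subst (x ∈_) (sym rem≡) (x∈p∧x≢y⇒x∈p-y x∈rem x≢b))
    Nonempty-B-b : Nonempty (B - b)
    Nonempty-B-b = let (x , x∈) = Nonempty-rem-b in x , p⊆q⇒p-x⊆q-x rem⊆B x∈

  move-progress : ∀ {s : State S} {j b} → NoBlocking s → Movable s j b → UnblockedStep s ⊎ ∃ (Obstructs s j b)
  move-progress {s} {j} {b} unblocked movable with move s j b movable
  ... | t , relocation with anyBlocking? t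
  ...   | no unblocked-t     = inj₁ (t , move-Step {s} {t} movable relocation , unblocked-t)
  ...   | yes (B , blocking) = inj₂ (B , move-blocked {s} {t} unblocked (proj₁ movable) relocation blocking)

  NearlyBlocking-progress : ∀ {s : State S} {b B} → NoBlocking s → ∣ jobsOn s b ∣ < cap b → Acc _⊂_ B →
    NearlyBlocking s b B → UnblockedStep s
  NearlyBlocking-progress {s} {b} {B} unblocked free (acc smaller) nearly@(_ , _ , closed , _)
    with any? (λ j → any? λ a → (pos s j ≟ᴸ mach a) ×-dec (a ∈? (B - b)) ×-dec (b ∈? rem s j))
  ... | no none = ⊥-elim (unblocked (B - b ,
    NearlyBlocking⇒Blocking {s} nearly λ j a j-on-a a∈ b∈rem → none (j , a , j-on-a , a∈ , b∈rem)))
  ... | yes (j , a , j-on-a , a∈ , b∈rem) with move-progress {s} unblocked (b∈rem , free)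
  ...   | inj₁ step = step
  ...   | inj₂ (B′ , nearly′ , rem⊆B′ , (x , x∈) , off-B′) =
    NearlyBlocking-progress {s} unblocked free (smaller B∩B′⊂B)
      (NearlyBlocking-∩ {s} nearly nearly′ (x , p⊆q⇒p-x⊆q-x (λ y∈ → x∈p∩q⁺ (rem⊆B y∈ , rem⊆B′ y∈)) x∈))
    where
    a∈B : a ∈ B
    a∈B = x∈p-y⇒x∈p a∈
    rem⊆B : rem s j ⊆ B
    rem⊆B = proj₂ (closed j a j-on-a a∈B)
    B∩B′⊂B : B ∩ B′ ⊂ B
    B∩B′⊂B = (λ y∈ → proj₁ (x∈p∩q⁻ B B′ y∈)) , a , a∈B ,
             λ a∈B∩B′ → off-B′ a (proj₂ (x∈p∩q⁻ B B′ a∈B∩B′)) j-on-a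

  movable-progress : ∀ {s : State S} {j b} → NoBlocking s → Movable s j b → UnblockedStep s
  movable-progress {s} unblocked movable with move-progress {s} unblocked movable
  ... | inj₁ step             = step
  ... | inj₂ (B , nearly , _) =
    NearlyBlocking-progress {s} unblocked (proj₂ movable) (⊂-wellFounded B) nearly

  Finished : State S → Fin n → Set
  Finished s j = pos s j ≡ done × rem s j ≡ ∅

  finished? : ∀ (s : State S) j → Dec (Finished s j)
  finished? s j = (pos s j ≟ᴸ done) ×-dec (rem s j ≟ˢ ∅)

  fullMachines : State S → Subset m
  fullMachines s = tabulate (λ i → ⌊ ∣ jobsOn s i ∣ ℕ.≟ cap i ⌋)

  stuck⇒Blocking : ∀ {s : State S} → ¬ IsFinal s → (∀ j → ¬ Finishable s j) → (∀ j b → ¬ Movable s j b) →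
    Blocking s (fullMachines s)
  stuck⇒Blocking {s} ¬final ¬finishable ¬movable = nonempty , full , closed
    where
    needed⇒full : ∀ j {b} → b ∈ rem s j → b ∈ fullMachines s
    needed⇒full j {b} b∈rem =
      ∈-tabulate⁺ (fromWitness (≤-antisym (capOK s b) (≮⇒≥ λ free → ¬movable j b (b∈rem , free))))
    pending : ∀ j → ¬ Finished s j → Nonempty (rem s j)
    pending j ¬finished = decidable-stable (nonempty? (rem s j)) λ idle →
      let j-done = decidable-stable (pos s j ≟ᴸ done) (λ ¬done → ¬finishable j (Empty-unique idle , ¬done))
      in ¬finished (j-done , Empty-unique idle)
    full : ∀ i → i ∈ fullMachines s → Full s i
    full i i∈ = toWitness (∈-tabulate⁻ i∈)
    closed : Closed s (fullMachines s)
    closed j i j-on-i _ = pending j (λ (j-done , _) → done≢mach (trans (sym j-done) j-on-i)) , needed⇒full j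
    nonempty : Nonempty (fullMachines s)
    nonempty = let (j , ¬finished) = ¬∀⟶∃¬ n (Finished s) (finished? s) ¬final
                   (x , x∈rem) = pending j ¬finished
               in x , needed⇒full j x∈rem

  progress : ∀ {s : State S} → NoBlocking s → ¬ IsFinal s → UnblockedStep s
  progress {s} unblocked ¬final with any? (λ j → (rem s j ≟ˢ ∅) ×-dec ¬? (pos s j ≟ᴸ done))
  ... | yes (j , finishable) = let (t , relocation) = finish s j in
    t , finish-Step {s} {t} finishable relocation , finish-unblocked {s} {t} relocation unblocked
  ... | no ¬finishable with any? (λ j → any? λ b → (b ∈? rem s j) ×-dec (∣ jobsOn s b ∣ ℕ.<? cap b))
  ...   | yes (_ , _ , movable) = movable-progress {s} unblocked movable
  ...   | no ¬movable = ⊥-elim (unblocked (fullMachines s ,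
    stuck⇒Blocking {s} ¬final (λ j finishable → ¬finishable (j , finishable))
                              (λ j b movable → ¬movable (j , b , movable))))

  unfinished : Loc m → ℕ
  unfinished done = 0
  unfinished _    = 1

  unfinished-≢done : ∀ l → l ≢ done → unfinished l ≡ 1
  unfinished-≢done start    _     = refl
  unfinished-≢done (mach _) _     = refl
  unfinished-≢done done     ¬done = ⊥-elim (¬done refl)

  -- A job may sit on the terminal machine with machines still to visit, and moving it
  -- back makes it unfinished again; the factor 2 on the remaining machines pays for that.
  work : State S → Fin n → ℕ
  work s j = ∣ rem s j ∣ + ∣ rem s j ∣ + unfinished (pos s j)

  Others⇒work≡ : ∀ {s t : State S} {j} → Others s t j → ∀ k → k ≢ j → work t k ≡ work s k
  Others⇒work≡ others k k≢j rewrite proj₁ (others k k≢j) | proj₂ (others k k≢j) = refl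

  Step-decreases-work : ∀ {s t : State S} → Step s t → ∑ (work t) < ∑ (work s)
  Step-decreases-work {s} {t} (j , others , inj₁ (b , b∈rem , _ , t-on-b , rem≡)) =
    ∑-< (work s) (work t) j (Others⇒work≡ {s} {t} others) moved
    where
    moved : work t j < work s j
    moved rewrite t-on-b | rem≡ = x<y⇒x+x+1<y+y+z _ (x∈p⇒∣p-x∣<∣p∣ b∈rem)
  Step-decreases-work {s} {t} (j , others , inj₂ (rem≡∅ , ¬done , t-done , rem≡)) =
    ∑-< (work s) (work t) j (Others⇒work≡ {s} {t} others) finished
    where
    finished : work t j < work s j
    finished rewrite t-done | rem≡ | rem≡∅ | unfinished-≢done (pos s j) ¬done =
      +-monoʳ-< (∣ ∅ {m} ∣ + ∣ ∅ {m} ∣) (s≤s z≤n)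

  NoBlocking⇒Safe : ∀ {s : State S} → NoBlocking s → Safe s
  NoBlocking⇒Safe {s} = go (On.wellFounded (∑ ∘ work) <-wellFounded s)
    where
    go : ∀ {s : State S} → Acc (_<_ on (∑ ∘ work)) s → NoBlocking s → Safe s
    go {s} (acc smaller) unblocked with all? (finished? s)
    ... | yes final = s , ε , final
    ... | no ¬final =
      let (t , step , unblocked-t) = progress {s} unblocked ¬final
          (f , reaches , final)    = go {t} (smaller (Step-decreases-work {s} {t} step)) unblocked-t
      in f , step ◅ reaches , final

theorem3p2 : (S : OpenShop) (s : State S) →
    (NotSafe s → ∃ λ (B : Subset (OpenShop.m S)) → Blocking s B)
    × ((∃ λ (B : Subset (OpenShop.m S)) → Blocking s B) → NotSafe s)
theorem3p2 S s = unsafe⇒Blocking , Blocking⇒unsafe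
  where
  unsafe⇒Blocking : NotSafe s → ∃ (Blocking s)
  unsafe⇒Blocking unsafe = decidable-stable (anyBlocking? s) (unsafe ∘ NoBlocking⇒Safe {s = s})
  Blocking⇒unsafe : ∃ (Blocking s) → NotSafe s
  Blocking⇒unsafe (B , blocking) (f , reaches , final) =
    IsFinal⇒¬Blocking {f = f} final (Reachable-preserves-Blocking {s = s} {t = f} reaches blocking)
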